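{- Let $G$ be a graph of order $n$, size $m$, diameter $d$, with $k$ peripheral vertices. Then \[ d\left\lceil \frac{k}{2}\right\rceil-(d-3)\left[\binom{n}{2}-\binom{k}{2}\right]-m\;\le\; PW(G)\;\le\;(d-1)\binom{n}{2}+(d+1)\binom{k}{2}-(d-2)m-(d-1)\left\lceil\frac{k}{2}\right\rceil. \]
   Context: All graphs are finite, simple, undirected, connected and have at least two vertices; the size is the number of edges. $d(u,v)$ is the shortest-path distance. The eccentricity of $v$ is $\max_u d(u,v)$; the diameter is the maximum eccentricity; a vertex is peripheral if its eccentricity equals the diameter, and $\operatorname{Peri}(G)$ is the set of peripheral vertices. The peripheral Wiener index is $PW(G)=\sum_{\{u,v\}\subseteq\operatorname{Peri}(G)} d(u,v)$, the sum over unordered pairs of distinct peripheral vertices. -}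

module Defs where

open import Data.Bool using (Bool; true; false; _∧_; _∨_; if_then_else_)
open import Data.Nat using (ℕ; zero; suc; _⊔_; _≡ᵇ_)
open import Data.Fin using (Fin; _≟_)
open import Data.List using (List; []; _∷_; map; _++_; foldr; filterᵇ; length; allFin)
open import Data.Bool.ListAction using (any)
open import Data.Nat.ListAction using (sum)
open import Data.Product using (_×_; _,_; uncurry)
open import Relation.Nullary.Decidable using (isYes)
open import Relation.Binary.PropositionalEquality using (_≡_)

record Graph (n : ℕ) : Set where
  field
    adj    : Fin n → Fin n → Bool
    adjSym : ∀ i j → adj i j ≡ adj j i
    loopless : ∀ i → adj i i ≡ false
open Graph public

data Walk {n : ℕ} (G : Graph n) : Fin n → Fin n → ℕ → Set where
  here : ∀ {u} → Walk G u u 0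
  step : ∀ {u w v ℓ} → adj G u w ≡ true → Walk G w v ℓ → Walk G u v (suc ℓ)

Connected : ∀ {n} → Graph n → Set
Connected G = ∀ u v → Data.Product.∃ (λ ℓ → Walk G u v ℓ)

reach : ∀ {n} → Graph n → ℕ → Fin n → Fin n → Bool
reach {n} G zero    u v = isYes (u ≟ v)
reach {n} G (suc k) u v = reach G k u v ∨ any (λ w → reach G k u w ∧ adj G w v) (allFin n)

-- Shortest-path distance: least k (searched in 0..n) with reach G k u v.
-- (For connected graphs the distance is at most n - 1, so the search bound is never hit.)
distSearch : ∀ {n} → Graph n → Fin n → Fin n → ℕ → ℕ → ℕ
distSearch G u v zero    k = k
distSearch G u v (suc f) k = if reach G k u v then k else distSearch G u v f (suc k)

dist : ∀ {n} → Graph n → Fin n → Fin n → ℕ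
dist {n} G u v = distSearch G u v n 0

maxList : List ℕ → ℕ
maxList = foldr _⊔_ 0

ecc : ∀ {n} → Graph n → Fin n → ℕ
ecc {n} G v = maxList (map (λ u → dist G u v) (allFin n))

diam : ∀ {n} → Graph n → ℕ
diam {n} G = maxList (map (ecc G) (allFin n))

peri : ∀ {n} → Graph n → List (Fin n)
peri {n} G = filterᵇ (λ v → ecc G v ≡ᵇ diam G) (allFin n)

pairs : ∀ {A : Set} → List A → List (A × A)
pairs []       = []
pairs (x ∷ xs) = map (x ,_) xs ++ pairs xs

size : ∀ {n} → Graph n → ℕ
size {n} G = length (filterᵇ (uncurry (adj G)) (pairs (allFin n)))

PW : ∀ {n} → Graph n → ℕ
PW G = sum (map (uncurry (dist G)) (pairs (peri G)))

{-# OPTIONS --safe #-}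
module Submission where

-- Sum over all pairs {u, v} of vertices, writing c = C(k,2) and N = C(n,2). A pair of
-- peripheral vertices contributes 1 to PW(G) if it is an edge and between 2 and d otherwise;
-- this gives 2c ≤ PW(G) + m and PW(G) + (d-1)m ≤ c + (d-1)N. If d = 1 every vertex is
-- peripheral (N = c), and if d = 2 every pair with a non-peripheral end is an edge
-- (N + c ≤ PW(G) + m). A vertex farthest from one of maximum eccentricity is peripheral too,
-- so k ≥ 2 and PW(G) ≥ d. With ⌈k/2⌉ ≤ c and k⌈k/2⌉ ≤ 2c these inequalities give both
-- bounds, after a case split on d = 1, d = 2 and d ≥ 3.

open import Defs
open import Algebra.Properties.CommutativeSemigroup using (interchange)
open import Data.Bool using (Bool; true; false; T; _∧_; if_then_else_)
open import Data.Bool.Properties using (T-∧; T-∨; T-≡; ⇔→≡)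
open import Data.Fin using (Fin) renaming (zero to fzero; suc to fsuc)
open import Data.List using (List; []; _∷_; map; _++_; filterᵇ; length; allFin)
open import Data.List.Membership.Propositional using (_∈_; lose)
open import Data.List.Membership.Propositional.Properties using (∈-allFin; ∈-map⁺; ∈-map⁻; ∈-filter⁺; ∈-++⁺ˡ; ∈-++⁺ʳ; ∈-++⁻; foldr-selective)
open import Data.List.Properties using (foldr-preservesᵇ; length-filter; length-tabulate; filter-++; filter-none; length-++; length-map)
open import Data.List.Relation.Unary.All as All using (All)
open import Data.List.Relation.Unary.All.Properties using (map⁺; tabulate⁺)
open import Data.List.Relation.Unary.AllPairs using (_∷_)
open import Data.List.Relation.Unary.Any as Any using (here; there)
open import Data.List.Relation.Unary.Any.Properties using (any⁺; any⁻)
open import Data.List.Relation.Unary.Unique.Propositional using (Unique)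
open import Data.List.Relation.Unary.Unique.Propositional.Properties using (allFin⁺)
open import Data.Nat using (ℕ; zero; suc; ⌈_/2⌉; _≤_; _<_; _≤′_; ≤′-refl; ≤′-step; z≤n; s≤s; z<s; _≡ᵇ_)
open import Data.Nat.Combinatorics using (_C_; nC1≡n; nCk+nC[k+1]≡[n+1]C[k+1])
open import Data.Nat.ListAction using (sum)
open import Data.Nat.Properties
open import Data.Product using (_×_; _,_; ∃-syntax; proj₁; proj₂; uncurry)
import Data.Product as Product
open import Data.Sum using (_⊎_; inj₁; inj₂; [_,_])
import Data.Sum as Sum
open import Function using (_∘_; const; Equivalence; mk⇔)
open import Relation.Binary.PropositionalEquality using (_≡_; _≢_; refl; sym; trans; cong; cong₂; subst; subst₂; module ≡-Reasoning)
open import Relation.Nullary using (¬_; contradiction)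
open import Relation.Nullary.Decidable using (toWitness; fromWitness; T?)

open Equivalence using (to; from)

-- ℕ's _+_ and _*_ are opened only inside this module: the theorem is stated with those of ℤ.
module _ where
  open import Data.Nat using (_+_; _*_)
  open import Data.Nat.Tactic.RingSolver using (solve-∀; solve)

  private
    variable
      A : Set

  -- Binomial coefficients and ⌈k/2⌉

  C₂-suc : ∀ n → n + n C 2 ≡ suc n C 2
  C₂-suc n = trans (cong (_+ n C 2) (sym (nC1≡n n))) (nCk+nC[k+1]≡[n+1]C[k+1] n 1)

  C₂-mono : ∀ {m n} → m ≤ n → m C 2 ≤ n C 2
  C₂-mono = C₂-mono′ ∘ ≤⇒≤′
    where
    C₂-mono′ : ∀ {m n} → m ≤′ n → m C 2 ≤ n C 2
    C₂-mono′ ≤′-refl            = ≤-refl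
    C₂-mono′ (≤′-step {n} m≤′n) =
      ≤-trans (C₂-mono′ m≤′n) (subst (n C 2 ≤_) (C₂-suc n) (m≤n+m (n C 2) n))

  C₂-double : ∀ k → k C 2 + k C 2 + k ≡ k * k
  C₂-double zero    = refl
  C₂-double (suc k) = begin
    suc k C 2 + suc k C 2 + suc k         ≡⟨ cong (λ c → c + c + suc k) (C₂-suc k) ⟨
    (k + k C 2) + (k + k C 2) + suc k     ≡⟨ regroup k (k C 2) ⟩
    (k C 2 + k C 2 + k) + suc (k + k)     ≡⟨ cong (_+ suc (k + k)) (C₂-double k) ⟩
    k * k + suc (k + k)                   ≡⟨ square-suc k ⟩
    suc k * suc k                         ∎
    where
    open ≡-Reasoning
    regroup : ∀ k c → (k + c) + (k + c) + suc k ≡ (c + c + k) + suc (k + k)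
    regroup = solve-∀
    square-suc : ∀ k → k * k + suc (k + k) ≡ suc k * suc k
    square-suc = solve-∀

  ⌈k/2⌉<k : ∀ {k} → 2 ≤ k → ⌈ k /2⌉ < k
  ⌈k/2⌉<k {suc (suc j)} (s≤s (s≤s _)) = ⌈n/2⌉<n j

  ⌈k/2⌉≤kC2 : ∀ {k} → 2 ≤ k → ⌈ k /2⌉ ≤ k C 2
  ⌈k/2⌉≤kC2 {suc (suc j)} 2≤k@(s≤s (s≤s _)) =
    ≤-trans (≤-pred (⌈k/2⌉<k 2≤k)) (subst (suc j ≤_) (C₂-suc (suc j)) (m≤m+n (suc j) (suc j C 2)))

  k*⌈k/2⌉≤kC2+kC2 : ∀ {k} → 2 ≤ k → k * ⌈ k /2⌉ ≤ k C 2 + k C 2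
  k*⌈k/2⌉≤kC2+kC2 {k} 2≤k = +-cancelʳ-≤ k _ _ (begin
    k * ⌈ k /2⌉ + k       ≡⟨ trans (*-suc k ⌈ k /2⌉) (+-comm k _) ⟨
    k * suc ⌈ k /2⌉       ≤⟨ *-monoʳ-≤ k (⌈k/2⌉<k 2≤k) ⟩
    k * k                 ≡⟨ C₂-double k ⟨
    k C 2 + k C 2 + k     ∎)
    where open ≤-Reasoning

  -- Sums over lists and the list of pairs

  sumOf : (A → ℕ) → List A → ℕ
  sumOf f xs = sum (map f xs)

  sumOf-mono : ∀ {f g : A → ℕ} xs → (∀ {x} → x ∈ xs → f x ≤ g x) → sumOf f xs ≤ sumOf g xs
  sumOf-mono []       f≤g = z≤n
  sumOf-mono (x ∷ xs) f≤g = +-mono-≤ (f≤g (here refl)) (sumOf-mono xs (f≤g ∘ there))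

  sumOf-+ : ∀ (f g : A → ℕ) xs → sumOf (λ x → f x + g x) xs ≡ sumOf f xs + sumOf g xs
  sumOf-+ f g []       = refl
  sumOf-+ f g (x ∷ xs) = trans (cong (f x + g x +_) (sumOf-+ f g xs))
                               (interchange +-commutativeSemigroup (f x) (g x) (sumOf f xs) (sumOf g xs))

  sumOf-* : ∀ k (f : A → ℕ) xs → sumOf (λ x → k * f x) xs ≡ k * sumOf f xs
  sumOf-* k f []       = sym (*-zeroʳ k)
  sumOf-* k f (x ∷ xs) =
    trans (cong (k * f x +_) (sumOf-* k f xs)) (sym (*-distribˡ-+ k (f x) (sumOf f xs)))

  sumOf-+-mono : ∀ {f₁ f₂ g₁ g₂ : A → ℕ} xs → (∀ {x} → x ∈ xs → f₁ x + f₂ x ≤ g₁ x + g₂ x) →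
                 sumOf f₁ xs + sumOf f₂ xs ≤ sumOf g₁ xs + sumOf g₂ xs
  sumOf-+-mono {f₁ = f₁} {f₂} {g₁} {g₂} xs f≤g =
    subst₂ _≤_ (sumOf-+ f₁ f₂ xs) (sumOf-+ g₁ g₂ xs) (sumOf-mono xs f≤g)

  ≤-sumOf : ∀ (f : A → ℕ) {x xs} → x ∈ xs → f x ≤ sumOf f xs
  ≤-sumOf f (here refl) = m≤m+n _ _
  ≤-sumOf f (there x∈xs) = ≤-trans (≤-sumOf f x∈xs) (m≤n+m _ _)

  sumOf-filterᵇ : ∀ (p : A → Bool) (f : A → ℕ) xs →
                  sumOf f (filterᵇ p xs) ≡ sumOf (λ x → if p x then f x else 0) xs
  sumOf-filterᵇ p f []       = refl
  sumOf-filterᵇ p f (x ∷ xs) with p x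
  ... | true  = cong (f x +_) (sumOf-filterᵇ p f xs)
  ... | false = sumOf-filterᵇ p f xs

  length≡sumOf-1 : ∀ (xs : List A) → length xs ≡ sumOf (const 1) xs
  length≡sumOf-1 []       = refl
  length≡sumOf-1 (x ∷ xs) = cong suc (length≡sumOf-1 xs)

  length-filterᵇ : ∀ (p : A → Bool) xs → length (filterᵇ p xs) ≡ sumOf (λ x → if p x then 1 else 0) xs
  length-filterᵇ p xs = trans (length≡sumOf-1 (filterᵇ p xs)) (sumOf-filterᵇ p (const 1) xs)

  filterᵇ-map : ∀ {B : Set} (p : B → Bool) (f : A → B) xs → filterᵇ p (map f xs) ≡ map f (filterᵇ (p ∘ f) xs)
  filterᵇ-map p f []       = refl
  filterᵇ-map p f (x ∷ xs) with p (f x)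
  ... | true  = cong (f x ∷_) (filterᵇ-map p f xs)
  ... | false = filterᵇ-map p f xs

  bothᵇ : (A → Bool) → A × A → Bool
  bothᵇ p (x , y) = p x ∧ p y

  length-pairs : ∀ (xs : List A) → length (pairs xs) ≡ length xs C 2
  length-pairs []       = refl
  length-pairs (x ∷ xs) = begin
    length (map (x ,_) xs ++ pairs xs)          ≡⟨ length-++ (map (x ,_) xs) ⟩
    length (map (x ,_) xs) + length (pairs xs)  ≡⟨ cong₂ _+_ (length-map (x ,_) xs) (length-pairs xs) ⟩
    length xs + length xs C 2                   ≡⟨ C₂-suc (length xs) ⟩
    suc (length xs) C 2                         ∎
    where open ≡-Reasoning

  pairs-filterᵇ : ∀ (p : A → Bool) xs → pairs (filterᵇ p xs) ≡ filterᵇ (bothᵇ p) (pairs xs)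
  pairs-filterᵇ p []       = refl
  pairs-filterᵇ p (x ∷ xs) = sym (begin
    filterᵇ (bothᵇ p) (map (x ,_) xs ++ pairs xs)
      ≡⟨ filter-++ _ (map (x ,_) xs) (pairs xs) ⟩
    filterᵇ (bothᵇ p) (map (x ,_) xs) ++ filterᵇ (bothᵇ p) (pairs xs)
      ≡⟨ cong₂ _++_ (filterᵇ-map (bothᵇ p) (x ,_) xs) (sym (pairs-filterᵇ p xs)) ⟩
    map (x ,_) (filterᵇ (λ y → p x ∧ p y) xs) ++ pairs (filterᵇ p xs)
      ≡⟨ first-row ⟩
    pairs (filterᵇ p (x ∷ xs)) ∎)
    where
    open ≡-Reasoning
    first-row : map (x ,_) (filterᵇ (λ y → p x ∧ p y) xs) ++ pairs (filterᵇ p xs) ≡ pairs (filterᵇ p (x ∷ xs))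
    first-row with p x
    ... | true  = refl
    ... | false = cong (λ ys → map (x ,_) ys ++ pairs (filterᵇ p xs))
                       (filter-none _ (All.universal (λ _ ()) xs))

  ∈-pairs⁺ : ∀ {x y : A} {xs} → x ∈ xs → y ∈ xs → x ≢ y → (x , y) ∈ pairs xs ⊎ (y , x) ∈ pairs xs
  ∈-pairs⁺ (here refl)  (here refl)  x≢y = contradiction refl x≢y
  ∈-pairs⁺ (here refl)  (there y∈xs) _   = inj₁ (∈-++⁺ˡ (∈-map⁺ _ y∈xs))
  ∈-pairs⁺ (there x∈xs) (here refl)  _   = inj₂ (∈-++⁺ˡ (∈-map⁺ _ x∈xs))
  ∈-pairs⁺ {xs = z ∷ zs} (there x∈xs) (there y∈xs) x≢y with ∈-pairs⁺ x∈xs y∈xs x≢y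
  ... | inj₁ xy∈ = inj₁ (∈-++⁺ʳ (map (z ,_) zs) xy∈)
  ... | inj₂ yx∈ = inj₂ (∈-++⁺ʳ (map (z ,_) zs) yx∈)

  ∈-pairs⇒≢ : ∀ {x y : A} {xs} → Unique xs → (x , y) ∈ pairs xs → x ≢ y
  ∈-pairs⇒≢ {xs = z ∷ zs} (z∉zs ∷ unique) xy∈ with ∈-++⁻ (map (z ,_) zs) xy∈
  ... | inj₂ xy∈rest = ∈-pairs⇒≢ unique xy∈rest
  ... | inj₁ xy∈row with ∈-map⁻ (z ,_) xy∈row
  ...   | _ , y∈zs , refl = All.lookup z∉zs y∈zs

  2≤length : ∀ {x y : A} {xs} → x ∈ xs → y ∈ xs → x ≢ y → 2 ≤ length xs
  2≤length (here refl) (here refl) x≢y = contradiction refl x≢y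
  2≤length {xs = _ ∷ _ ∷ _} (here refl) (there _) _ = s≤s (s≤s z≤n)
  2≤length {xs = _ ∷ _ ∷ _} (there _) (here refl) _ = s≤s (s≤s z≤n)
  2≤length (there x∈xs) (there y∈xs) x≢y = m≤n⇒m≤1+n (2≤length x∈xs y∈xs x≢y)

  ≤-maxList : ∀ {x xs} → x ∈ xs → x ≤ maxList xs
  ≤-maxList (here refl)  = m≤m⊔n _ _
  ≤-maxList (there x∈xs) = m≤n⇒m≤o⊔n _ (≤-maxList x∈xs)

  maxList-≤ : ∀ {b xs} → All (_≤ b) xs → maxList xs ≤ b
  maxList-≤ = foldr-preservesᵇ ⊔-lub z≤n

  maxList-map-attained : ∀ (f : A → ℕ) {x xs} → x ∈ xs → ∃[ y ] maxList (map f xs) ≡ f y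
  maxList-map-attained f {x} {xs} x∈xs with foldr-selective ⊔-sel 0 (map f xs)
  ... | inj₁ max≡0 = x , trans max≡0 (sym (n≤0⇒n≡0 (subst (f x ≤_) max≡0 (≤-maxList (∈-map⁺ f x∈xs)))))
  ... | inj₂ max∈  with ∈-map⁻ f max∈
  ...   | y , _ , max≡fy = y , max≡fy

  -- The arithmetic of the two bounds

  -- Counting facts about a graph with n vertices, k of them peripheral, diameter d, m edges
  -- and PW(G) = P; k C 2 counts the pairs of peripheral vertices and n C 2 all pairs.
  record PeripheralCounts (n k d m P : ℕ) : Set where
    field
      2≤k                : 2 ≤ k
      k≤n                : k ≤ n
      0<d                : 0 < d
      d≤n                : d ≤ n
      d≤P                : d ≤ P
      upper-count        : ∀ e → d ≤ suc e → P + e * m ≤ k C 2 + e * (n C 2)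
      lower-count        : k C 2 + k C 2 ≤ P + m
      diameter-one-count : d ≡ 1 → n C 2 ≤ k C 2
      diameter-two-count : d ≡ 2 → n C 2 + k C 2 ≤ P + m

  upper-cleared-suc : ∀ e {P m h c N} → P + e * m ≤ c + e * N → h ≤ c →
                      P + suc e * m + suc e * h + N ≤ suc e * N + suc e * c + c + 2 * m + h
  upper-cleared-suc e {P} {m} {h} {c} {N} upper h≤c = begin
    P + suc e * m + suc e * h + N                 ≡⟨ solve (e ∷ P ∷ m ∷ h ∷ N ∷ []) ⟩
    (P + e * m) + e * h + (m + h + N)             ≤⟨ +-monoˡ-≤ (m + h + N) (+-mono-≤ upper (*-monoʳ-≤ e h≤c)) ⟩
    (c + e * N) + e * c + (m + h + N)             ≤⟨ m≤m+n _ (c + m) ⟩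
    (c + e * N) + e * c + (m + h + N) + (c + m)   ≡⟨ solve (e ∷ m ∷ h ∷ c ∷ N ∷ []) ⟩
    suc e * N + suc e * c + c + 2 * m + h         ∎
    where open ≤-Reasoning

  -- The upper bound of the theorem with its negative terms moved to the other side.
  upper-cleared : ∀ {n k d m P} → PeripheralCounts n k d m P →
                  P + d * m + d * ⌈ k /2⌉ + n C 2 ≤ d * (n C 2) + d * (k C 2) + k C 2 + 2 * m + ⌈ k /2⌉
  upper-cleared {d = zero}  counts = contradiction (PeripheralCounts.0<d counts) n≮0
  upper-cleared {d = suc e} counts = upper-cleared-suc e (upper-count e ≤-refl) (⌈k/2⌉≤kC2 2≤k)
    where open PeripheralCounts counts

  -- In the lower bound, Y = C(n,2) - C(k,2) is the number of pairs with a non-peripheral end.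
  lower-excess-diameter-1 : ∀ {h c Y P m} → c + Y ≤ c → h ≤ c → c + c ≤ P + m →
                            1 * h + 3 * Y ≤ P + m + 1 * Y
  lower-excess-diameter-1 {h} {c} {Y} {P} {m} c+Y≤c h≤c lower
    with n≤0⇒n≡0 (+-cancelˡ-≤ c Y 0 (subst (c + Y ≤_) (sym (+-identityʳ c)) c+Y≤c))
  ... | refl = begin
    1 * h + 3 * 0   ≡⟨ solve (h ∷ []) ⟩
    h               ≤⟨ ≤-trans h≤c (m≤m+n c c) ⟩
    c + c           ≤⟨ lower ⟩
    P + m           ≡⟨ solve (P ∷ m ∷ []) ⟩
    P + m + 1 * 0   ∎
    where open ≤-Reasoning

  lower-excess-diameter-2 : ∀ {h c Y P m} → h ≤ c → (c + Y) + c ≤ P + m →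
                            2 * h + 3 * Y ≤ P + m + 2 * Y
  lower-excess-diameter-2 {h} {c} {Y} {P} {m} h≤c lower = begin
    2 * h + 3 * Y         ≡⟨ solve (h ∷ Y ∷ []) ⟩
    (h + h + Y) + 2 * Y   ≤⟨ +-monoˡ-≤ (2 * Y) (+-monoˡ-≤ Y (+-mono-≤ h≤c h≤c)) ⟩
    (c + c + Y) + 2 * Y   ≡⟨ solve (c ∷ Y ∷ []) ⟩
    ((c + Y) + c) + 2 * Y ≤⟨ +-monoˡ-≤ (2 * Y) lower ⟩
    P + m + 2 * Y         ∎
    where open ≤-Reasoning

  -- Either every vertex is peripheral, and then d ≤ k, or Y ≥ k (the pairs joining the k
  -- peripheral vertices to one further vertex); for k = 2 the bound d ≤ P suffices.
  large-diameter-bound : ∀ {n k e m P Y} → 2 ≤ k → k ≤ n → 3 + e ≤ n → 3 + e ≤ P →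
                         k C 2 + k C 2 ≤ P + m → k C 2 + Y ≡ n C 2 → (3 + e) * ⌈ k /2⌉ ≤ P + m + e * Y
  large-diameter-bound {n} {k} {e} {m} {P} {Y} 2≤k k≤n d≤n d≤P lower c+Y≡N with m≤n⇒m<n∨m≡n k≤n
  ... | inj₂ refl = begin
    (3 + e) * ⌈ k /2⌉   ≤⟨ *-monoˡ-≤ ⌈ k /2⌉ d≤n ⟩
    k * ⌈ k /2⌉         ≤⟨ k*⌈k/2⌉≤kC2+kC2 2≤k ⟩
    k C 2 + k C 2       ≤⟨ lower ⟩
    P + m               ≤⟨ m≤m+n (P + m) (e * Y) ⟩
    P + m + e * Y       ∎
    where open ≤-Reasoning
  ... | inj₁ k<n with m≤n⇒m<n∨m≡n 2≤k
  ...   | inj₂ refl = begin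
    (3 + e) * 1         ≡⟨ *-identityʳ (3 + e) ⟩
    3 + e               ≤⟨ d≤P ⟩
    P                   ≤⟨ ≤-trans (m≤m+n P m) (m≤m+n (P + m) (e * Y)) ⟩
    P + m + e * Y       ∎
    where open ≤-Reasoning
  ...   | inj₁ 3≤k = begin
    (3 + e) * ⌈ k /2⌉           ≡⟨ *-distribʳ-+ ⌈ k /2⌉ 3 e ⟩
    3 * ⌈ k /2⌉ + e * ⌈ k /2⌉   ≤⟨ +-mono-≤ (*-monoˡ-≤ ⌈ k /2⌉ 3≤k) (*-monoʳ-≤ e (≤-trans (⌈n/2⌉≤n k) k≤Y)) ⟩
    k * ⌈ k /2⌉ + e * Y         ≤⟨ +-monoˡ-≤ (e * Y) (≤-trans (k*⌈k/2⌉≤kC2+kC2 2≤k) lower) ⟩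
    P + m + e * Y               ∎
    where
    open ≤-Reasoning
    k≤Y : k ≤ Y
    k≤Y = +-cancelˡ-≤ (k C 2) k Y (begin
      k C 2 + k   ≡⟨ trans (+-comm (k C 2) k) (C₂-suc k) ⟩
      suc k C 2   ≤⟨ C₂-mono k<n ⟩
      n C 2       ≡⟨ c+Y≡N ⟨
      k C 2 + Y   ∎)

  lower-excess-diameter-3+ : ∀ e {h Y P m} → (3 + e) * h ≤ P + m + e * Y →
                             (3 + e) * h + 3 * Y ≤ P + m + (3 + e) * Y
  lower-excess-diameter-3+ e {h} {Y} {P} {m} bound = begin
    (3 + e) * h + 3 * Y     ≤⟨ +-monoˡ-≤ (3 * Y) bound ⟩
    P + m + e * Y + 3 * Y   ≡⟨ solve (e ∷ Y ∷ P ∷ m ∷ []) ⟩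
    P + m + (3 + e) * Y     ∎
    where open ≤-Reasoning

  lower-excess : ∀ {n k d m P Y} → PeripheralCounts n k d m P → k C 2 + Y ≡ n C 2 →
                 d * ⌈ k /2⌉ + 3 * Y ≤ P + m + d * Y
  lower-excess {d = zero} counts _ = contradiction (PeripheralCounts.0<d counts) n≮0
  lower-excess {k = k} {d = 1} {m} {P} counts c+Y≡N =
    lower-excess-diameter-1 {P = P} {m} (subst (_≤ k C 2) (sym c+Y≡N) (diameter-one-count refl))
                            (⌈k/2⌉≤kC2 2≤k) lower-count
    where open PeripheralCounts counts
  lower-excess {k = k} {d = 2} {m} {P} counts c+Y≡N =
    lower-excess-diameter-2 {P = P} {m} (⌈k/2⌉≤kC2 2≤k)
                            (subst (λ N → N + k C 2 ≤ P + m) (sym c+Y≡N) (diameter-two-count refl))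
    where open PeripheralCounts counts
  lower-excess {k = k} {d = suc (suc (suc e))} {m} {P} counts c+Y≡N =
    lower-excess-diameter-3+ e {⌈ k /2⌉} {P = P} {m}
                             (large-diameter-bound 2≤k k≤n d≤n d≤P lower-count c+Y≡N)
    where open PeripheralCounts counts

  lower-excess⇒lower-cleared : ∀ {d h c N P m Y} → c + Y ≡ N → d * h + 3 * Y ≤ P + m + d * Y →
                               d * h + d * c + 3 * N ≤ P + m + 3 * c + d * N
  lower-excess⇒lower-cleared {d} {h} {c} {_} {P} {m} {Y} refl excess = begin
    d * h + d * c + 3 * (c + Y)         ≡⟨ solve (d ∷ h ∷ c ∷ Y ∷ []) ⟩
    (d * h + 3 * Y) + (d * c + 3 * c)   ≤⟨ +-monoˡ-≤ (d * c + 3 * c) excess ⟩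
    (P + m + d * Y) + (d * c + 3 * c)   ≡⟨ solve (d ∷ c ∷ P ∷ m ∷ Y ∷ []) ⟩
    P + m + 3 * c + d * (c + Y)         ∎
    where open ≤-Reasoning

  lower-cleared : ∀ {n k d m P} → PeripheralCounts n k d m P →
                  d * ⌈ k /2⌉ + d * (k C 2) + 3 * (n C 2) ≤ P + m + 3 * (k C 2) + d * (n C 2)
  lower-cleared {k = k} {d} {m} {P} counts with m≤n⇒∃[o]m+o≡n (C₂-mono (PeripheralCounts.k≤n counts))
  ... | Y , c+Y≡N =
    lower-excess⇒lower-cleared {d} {⌈ k /2⌉} {P = P} {m} c+Y≡N (lower-excess counts c+Y≡N)

  -- Reachability, distance and eccentricity

  another-vertex : ∀ {n} → 2 ≤ n → (v : Fin n) → ∃[ u ] u ≢ v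
  another-vertex (s≤s (s≤s _)) fzero    = fsuc fzero , λ ()
  another-vertex (s≤s (s≤s _)) (fsuc _) = fzero , λ ()

  module _ {n : ℕ} (G : Graph n) where

    reach-zero⁻ : ∀ {u v} → T (reach G 0 u v) → u ≡ v
    reach-zero⁻ = toWitness

    reach-refl : ∀ u → T (reach G 0 u u)
    reach-refl u = fromWitness refl

    reach-suc⁺ : ∀ k {u v} → T (reach G k u v) → T (reach G (suc k) u v)
    reach-suc⁺ k r = from T-∨ (inj₁ r)

    reach-snoc : ∀ k {u w v} → T (reach G k u w) → T (adj G w v) → T (reach G (suc k) u v)
    reach-snoc k {u} {w} {v} r a =
      from T-∨ (inj₂ (any⁺ (λ w → reach G k u w ∧ adj G w v) (lose (∈-allFin w) (from T-∧ (r , a)))))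

    reach-suc⁻ : ∀ k {u v} → T (reach G (suc k) u v) →
                 T (reach G k u v) ⊎ ∃[ w ] T (reach G k u w) × T (adj G w v)
    reach-suc⁻ k {u} {v} r =
      Sum.map₂ (Product.map₂ (to T-∧) ∘ Any.satisfied ∘ any⁻ via (allFin n)) (to T-∨ r)
      where via = λ w → reach G k u w ∧ adj G w v

    reach-mono : ∀ {i j u v} → i ≤′ j → T (reach G i u v) → T (reach G j u v)
    reach-mono ≤′-refl            r = r
    reach-mono (≤′-step {j} i≤′j) r = reach-suc⁺ j (reach-mono i≤′j r)

    reach-cons : ∀ k {u w v} → T (adj G u w) → T (reach G k w v) → T (reach G (suc k) u v)
    reach-cons zero    {u} a r with reach-zero⁻ r
    ... | refl = reach-snoc 0 (reach-refl u) a
    reach-cons (suc k) a r with reach-suc⁻ k r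
    ... | inj₁ r′            = reach-suc⁺ (suc k) (reach-cons k a r′)
    ... | inj₂ (_ , r′ , a′) = reach-snoc (suc k) (reach-cons k a r′) a′

    reach-sym : ∀ k {u v} → T (reach G k u v) → T (reach G k v u)
    reach-sym zero r with reach-zero⁻ r
    ... | refl = r
    reach-sym (suc k) r with reach-suc⁻ k r
    ... | inj₁ r′            = reach-suc⁺ k (reach-sym k r′)
    ... | inj₂ (w , r′ , a′) = reach-cons k (subst T (adjSym G w _) a′) (reach-sym k r′)

    reach-sym-≡ : ∀ k u v → reach G k u v ≡ reach G k v u
    reach-sym-≡ k u v = ⇔→≡ (mk⇔ (swap u v) (swap v u))
      where
      swap : ∀ u v → reach G k u v ≡ true → reach G k v u ≡ true
      swap u v = to T-≡ ∘ reach-sym k ∘ from T-≡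

    reach-one⁻ : ∀ {u v} → T (reach G 1 u v) → u ≡ v ⊎ T (adj G u v)
    reach-one⁻ r with reach-suc⁻ 0 r
    ... | inj₁ r′ = inj₁ (reach-zero⁻ r′)
    ... | inj₂ (_ , r′ , a) with reach-zero⁻ r′
    ...   | refl = inj₂ a

    distSearch-≤ : ∀ f {j k u v} → k ≤ j → T (reach G j u v) → distSearch G u v f k ≤ j
    distSearch-≤ zero    k≤j _ = k≤j
    distSearch-≤ (suc f) {j} {k} {u} {v} k≤j r with reach G k u v in reach-k
    ... | true  = k≤j
    ... | false = distSearch-≤ f (≤∧≢⇒< k≤j k≢j) r
      where
      k≢j : k ≢ j
      k≢j refl = subst T reach-k r

    distSearch-> : ∀ f {j k u v} → j < f + k → ¬ T (reach G j u v) → j < distSearch G u v f k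
    distSearch-> zero    j<k _ = j<k
    distSearch-> (suc f) {j} {k} {u} {v} j<f+k ¬r with reach G k u v in reach-k
    ... | true  = ≰⇒> (λ k≤j → ¬r (reach-mono (≤⇒≤′ k≤j) (from T-≡ reach-k)))
    ... | false = distSearch-> f (subst (j <_) (sym (+-suc f k)) j<f+k) ¬r

    distSearch-bound : ∀ f {k u v} → distSearch G u v f k ≤ f + k
    distSearch-bound zero    = ≤-refl
    distSearch-bound (suc f) {k} {u} {v} with reach G k u v
    ... | true  = m≤n+m k (suc f)
    ... | false = subst (distSearch G u v f (suc k) ≤_) (+-suc f k) (distSearch-bound f)

    distSearch-sym : ∀ f {k} u v → distSearch G u v f k ≡ distSearch G v u f k
    distSearch-sym zero    u v = refl
    distSearch-sym (suc f) {k} u v rewrite reach-sym-≡ k u v =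
      cong (if reach G k v u then k else_) (distSearch-sym f u v)

    dist-≤ : ∀ {j u v} → T (reach G j u v) → dist G u v ≤ j
    dist-≤ = distSearch-≤ n z≤n

    dist-> : ∀ {j u v} → j < n → ¬ T (reach G j u v) → j < dist G u v
    dist-> {j} j<n = distSearch-> n (subst (j <_) (sym (+-identityʳ n)) j<n)

    dist≤n : ∀ u v → dist G u v ≤ n
    dist≤n u v = subst (dist G u v ≤_) (+-identityʳ n) (distSearch-bound n)

    dist-sym : ∀ u v → dist G u v ≡ dist G v u
    dist-sym = distSearch-sym n

    dist-self : ∀ u → dist G u u ≡ 0
    dist-self u = n≤0⇒n≡0 (dist-≤ (reach-refl u))

    dist-adj : ∀ {u v} → adj G u v ≡ true → dist G u v ≤ 1
    dist-adj {u} uv = dist-≤ (reach-snoc 0 (reach-refl u) (from T-≡ uv))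

    dist-pos : ∀ {u v} → u ≢ v → 0 < dist G u v
    dist-pos {u} u≢v = dist-> (positive u) (u≢v ∘ reach-zero⁻)
      where
      positive : Fin n → 0 < n
      positive fzero    = z<s
      positive (fsuc _) = z<s

    dist-nonadj : ∀ {u v} → 2 ≤ n → u ≢ v → adj G u v ≡ false → 2 ≤ dist G u v
    dist-nonadj 2≤n u≢v ¬uv = dist-> 2≤n ([ u≢v , subst T ¬uv ] ∘ reach-one⁻)

    dist≤ecc : ∀ u v → dist G u v ≤ ecc G v
    dist≤ecc u v = ≤-maxList (∈-map⁺ (λ u → dist G u v) (∈-allFin u))

    ecc≤diam : ∀ v → ecc G v ≤ diam G
    ecc≤diam v = ≤-maxList (∈-map⁺ (ecc G) (∈-allFin v))

    dist≤diam : ∀ u v → dist G u v ≤ diam G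
    dist≤diam u v = ≤-trans (dist≤ecc u v) (ecc≤diam v)

    ecc≤n : ∀ v → ecc G v ≤ n
    ecc≤n v = maxList-≤ (map⁺ (tabulate⁺ (λ u → dist≤n u v)))

    diam≤n : diam G ≤ n
    diam≤n = maxList-≤ (map⁺ (tabulate⁺ ecc≤n))

    ecc-attained : ∀ v → ∃[ u ] dist G u v ≡ ecc G v
    ecc-attained v = Product.map₂ sym (maxList-map-attained (λ u → dist G u v) (∈-allFin v))

    diam-attained : 0 < n → ∃[ v ] ecc G v ≡ diam G
    diam-attained (s≤s _) = Product.map₂ sym (maxList-map-attained (ecc G) (∈-allFin fzero))

    0<ecc : 2 ≤ n → ∀ v → 0 < ecc G v
    0<ecc 2≤n v with another-vertex 2≤n v
    ... | u , u≢v = ≤-trans (dist-pos u≢v) (dist≤ecc u v)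

    isPeripheral : Fin n → Bool
    isPeripheral v = ecc G v ≡ᵇ diam G

    ∈-peri : ∀ {v} → ecc G v ≡ diam G → v ∈ peri G
    ∈-peri {v} ecc≡diam = ∈-filter⁺ (T? ∘ isPeripheral) (∈-allFin v) (≡⇒≡ᵇ _ _ ecc≡diam)

    peripheral-pair : 2 ≤ n → ∃[ u ] ∃[ v ] u ∈ peri G × v ∈ peri G × u ≢ v × dist G u v ≡ diam G
    peripheral-pair 2≤n with diam-attained (≤-trans (s≤s z≤n) 2≤n)
    ... | v , ecc-v with ecc-attained v
    ...   | u , dist-uv = u , v , ∈-peri ecc-u , ∈-peri ecc-v , u≢v , trans dist-uv ecc-v
      where
      ecc-u : ecc G u ≡ diam G
      ecc-u = ≤-antisym (ecc≤diam u) (begin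
        diam G     ≡⟨ trans dist-uv ecc-v ⟨
        dist G u v ≡⟨ dist-sym u v ⟩
        dist G v u ≤⟨ dist≤ecc v u ⟩
        ecc G u    ∎)
        where open ≤-Reasoning
      u≢v : u ≢ v
      u≢v refl = <⇒≢ (0<ecc 2≤n u) (trans (sym (dist-self u)) dist-uv)

    diam≡1⇒peripheral : 2 ≤ n → diam G ≡ 1 → ∀ v → isPeripheral v ≡ true
    diam≡1⇒peripheral 2≤n d≡1 v =
      to T-≡ (≡⇒≡ᵇ _ _ (≤-antisym (ecc≤diam v) (subst (_≤ ecc G v) (sym d≡1) (0<ecc 2≤n v))))

    diam≡2⇒adj : 2 ≤ n → diam G ≡ 2 → ∀ {u v} → isPeripheral v ≡ false → u ≢ v → adj G u v ≡ true
    diam≡2⇒adj 2≤n d≡2 {u} {v} ¬pv u≢v with adj G u v in uv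
    ... | true  = refl
    ... | false = contradiction (≤-trans (dist-nonadj 2≤n u≢v uv) (dist≤ecc u v)) (<⇒≱ ecc<2)
      where
      ecc<2 : ecc G v < 2
      ecc<2 = ≤∧≢⇒< (subst (ecc G v ≤_) d≡2 (ecc≤diam v))
                    (λ ecc≡2 → subst T ¬pv (≡⇒≡ᵇ _ _ (trans ecc≡2 (sym d≡2))))

    -- Counting over all pairs of vertices

    module _ (2≤n : 2 ≤ n) where

      peripheral-distance peripheral-pair-indicator edge-indicator : Fin n × Fin n → ℕ
      peripheral-distance       q = if bothᵇ isPeripheral q then uncurry (dist G) q else 0
      peripheral-pair-indicator q = if bothᵇ isPeripheral q then 1 else 0
      edge-indicator            q = if uncurry (adj G) q then 1 else 0

      PW≡sumOf : PW G ≡ sumOf peripheral-distance (pairs (allFin n))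
      PW≡sumOf = trans (cong (sumOf (uncurry (dist G))) (pairs-filterᵇ isPeripheral (allFin n)))
                       (sumOf-filterᵇ (bothᵇ isPeripheral) (uncurry (dist G)) (pairs (allFin n)))

      kC2≡sumOf : length (peri G) C 2 ≡ sumOf peripheral-pair-indicator (pairs (allFin n))
      kC2≡sumOf = trans (sym (length-pairs (peri G)))
                        (trans (cong length (pairs-filterᵇ isPeripheral (allFin n)))
                               (length-filterᵇ (bothᵇ isPeripheral) (pairs (allFin n))))

      size≡sumOf : size G ≡ sumOf edge-indicator (pairs (allFin n))
      size≡sumOf = length-filterᵇ (uncurry (adj G)) (pairs (allFin n))

      nC2≡sumOf : n C 2 ≡ sumOf (const 1) (pairs (allFin n))
      nC2≡sumOf = trans (cong (_C 2) (sym (length-tabulate {n = n} (λ v → v))))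
                        (trans (sym (length-pairs (allFin n))) (length≡sumOf-1 (pairs (allFin n))))

      distinct-pair : ∀ {q} → q ∈ pairs (allFin n) → proj₁ q ≢ proj₂ q
      distinct-pair = ∈-pairs⇒≢ (allFin⁺ n)

      2≤dist+adj : ∀ {u v} → u ≢ v → 2 ≤ dist G u v + (if adj G u v then 1 else 0)
      2≤dist+adj {u} {v} u≢v with adj G u v in uv
      ... | true  = +-monoˡ-≤ 1 (dist-pos u≢v)
      ... | false = subst (2 ≤_) (sym (+-identityʳ _)) (dist-nonadj 2≤n u≢v uv)

      upper-pointwise : ∀ e → diam G ≤ suc e → ∀ b q →
        (if b then uncurry (dist G) q else 0) + e * edge-indicator q ≤ (if b then 1 else 0) + e * 1
      upper-pointwise e d≤1+e true (u , v) with adj G u v in uv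
      ... | true  = +-monoˡ-≤ (e * 1) (dist-adj uv)
      ... | false = begin
        dist G u v + e * 0 ≡⟨ cong (dist G u v +_) (*-zeroʳ e) ⟩
        dist G u v + 0     ≡⟨ +-identityʳ _ ⟩
        dist G u v         ≤⟨ dist≤diam u v ⟩
        diam G             ≤⟨ d≤1+e ⟩
        1 + e              ≡⟨ cong suc (*-identityʳ e) ⟨
        1 + e * 1          ∎
        where open ≤-Reasoning
      upper-pointwise e _ false (u , v) with adj G u v
      ... | true  = ≤-refl
      ... | false = *-monoʳ-≤ e z≤n

      lower-pointwise : ∀ b q → proj₁ q ≢ proj₂ q →
        (if b then 1 else 0) + (if b then 1 else 0) ≤ (if b then uncurry (dist G) q else 0) + edge-indicator q
      lower-pointwise true  (u , v) u≢v = 2≤dist+adj u≢v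
      lower-pointwise false (u , v) u≢v = z≤n

      diameter-one-pointwise : diam G ≡ 1 → ∀ q → 1 ≤ peripheral-pair-indicator q
      diameter-one-pointwise d≡1 (u , v)
        rewrite diam≡1⇒peripheral 2≤n d≡1 u | diam≡1⇒peripheral 2≤n d≡1 v = ≤-refl

      diameter-two-pointwise : diam G ≡ 2 → ∀ q → proj₁ q ≢ proj₂ q →
        1 + peripheral-pair-indicator q ≤ peripheral-distance q + edge-indicator q
      diameter-two-pointwise d≡2 (u , v) u≢v with isPeripheral u in pu | isPeripheral v in pv
      ... | true  | true  = 2≤dist+adj u≢v
      ... | true  | false rewrite diam≡2⇒adj 2≤n d≡2 pv u≢v = ≤-refl
      ... | false | _     rewrite adjSym G u v | diam≡2⇒adj 2≤n d≡2 pu (u≢v ∘ sym) = ≤-refl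

      peripheral-counts : PeripheralCounts n (length (peri G)) (diam G) (size G) (PW G)
      peripheral-counts with peripheral-pair 2≤n
      ... | u , v , u∈peri , v∈peri , u≢v , uv≡d = record
        { 2≤k                = 2≤length u∈peri v∈peri u≢v
        ; k≤n                = subst (length (peri G) ≤_) (length-tabulate {n = n} (λ v → v))
                                     (length-filter (T? ∘ isPeripheral) (allFin n))
        ; 0<d                = subst (0 <_) uv≡d (dist-pos u≢v)
        ; d≤n                = diam≤n
        ; d≤P                = subst (_≤ PW G) uv≡d d-uv≤PW
        ; upper-count        = upper-count
        ; lower-count        = lower-count
        ; diameter-one-count = diameter-one-count
        ; diameter-two-count = diameter-two-count
        }
        where
        open ≤-Reasoning
        E = pairs (allFin n)
        k = length (peri G)

        d-uv≤PW : dist G u v ≤ PW G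
        d-uv≤PW with ∈-pairs⁺ u∈peri v∈peri u≢v
        ... | inj₁ uv∈ = ≤-sumOf (uncurry (dist G)) uv∈
        ... | inj₂ vu∈ = subst (_≤ PW G) (dist-sym v u) (≤-sumOf (uncurry (dist G)) vu∈)

        upper-count : ∀ e → diam G ≤ suc e → PW G + e * size G ≤ k C 2 + e * (n C 2)
        upper-count e d≤1+e = begin
          PW G + e * size G
            ≡⟨ cong₂ (λ p s → p + e * s) PW≡sumOf size≡sumOf ⟩
          sumOf peripheral-distance E + e * sumOf edge-indicator E
            ≡⟨ cong (sumOf peripheral-distance E +_) (sumOf-* e edge-indicator E) ⟨
          sumOf peripheral-distance E + sumOf (λ q → e * edge-indicator q) E
            ≤⟨ sumOf-+-mono E (λ {q} _ → upper-pointwise e d≤1+e (bothᵇ isPeripheral q) q) ⟩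
          sumOf peripheral-pair-indicator E + sumOf (λ _ → e * 1) E
            ≡⟨ cong (sumOf peripheral-pair-indicator E +_) (sumOf-* e (const 1) E) ⟩
          sumOf peripheral-pair-indicator E + e * sumOf (const 1) E
            ≡⟨ cong₂ (λ c N → c + e * N) kC2≡sumOf nC2≡sumOf ⟨
          k C 2 + e * (n C 2) ∎

        lower-count : k C 2 + k C 2 ≤ PW G + size G
        lower-count = begin
          k C 2 + k C 2
            ≡⟨ cong₂ _+_ kC2≡sumOf kC2≡sumOf ⟩
          sumOf peripheral-pair-indicator E + sumOf peripheral-pair-indicator E
            ≤⟨ sumOf-+-mono E (λ {q} q∈E → lower-pointwise (bothᵇ isPeripheral q) q (distinct-pair q∈E)) ⟩
          sumOf peripheral-distance E + sumOf edge-indicator E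
            ≡⟨ cong₂ _+_ PW≡sumOf size≡sumOf ⟨
          PW G + size G ∎

        diameter-one-count : diam G ≡ 1 → n C 2 ≤ k C 2
        diameter-one-count d≡1 = begin
          n C 2                                ≡⟨ nC2≡sumOf ⟩
          sumOf (const 1) E                    ≤⟨ sumOf-mono E (λ {q} _ → diameter-one-pointwise d≡1 q) ⟩
          sumOf peripheral-pair-indicator E    ≡⟨ kC2≡sumOf ⟨
          k C 2                                ∎

        diameter-two-count : diam G ≡ 2 → n C 2 + k C 2 ≤ PW G + size G
        diameter-two-count d≡2 = begin
          n C 2 + k C 2
            ≡⟨ cong₂ _+_ nC2≡sumOf kC2≡sumOf ⟩
          sumOf (const 1) E + sumOf peripheral-pair-indicator E
            ≤⟨ sumOf-+-mono E (λ {q} q∈E → diameter-two-pointwise d≡2 q (distinct-pair q∈E)) ⟩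
          sumOf peripheral-distance E + sumOf edge-indicator E
            ≡⟨ cong₂ _+_ PW≡sumOf size≡sumOf ⟨
          PW G + size G ∎

-- Transfer to ℤ

open import Data.Integer using (ℤ; 0ℤ; +_; +≤+; _+_; _-_; _*_) renaming (_≤_ to _≤ℤ_)
import Data.Integer.Properties as ℤ
open import Data.Integer.Tactic.RingSolver using (solve-∀)

≤ℤ-fromℕ : ∀ {a b : ℕ} {L R : ℤ} → a ≤ b → + b - + a ≡ R - L → L ≤ℤ R
≤ℤ-fromℕ a≤b b-a≡R-L = ℤ.0≤i-j⇒j≤i (subst (0ℤ ≤ℤ_) b-a≡R-L (ℤ.i≤j⇒0≤j-i (+≤+ a≤b)))

lower-identity : ∀ d h c N m P →
  (P + m + + 3 * c + d * N) - (d * h + d * c + + 3 * N) ≡ P - (d * h - (d - + 3) * (N - c) - m)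
lower-identity = solve-∀

upper-identity : ∀ d h c N m P →
  (d * N + d * c + c + + 2 * m + h) - (P + d * m + d * h + N) ≡
  ((d - + 1) * N + (d + + 1) * c - (d - + 2) * m - (d - + 1) * h) - P
upper-identity = solve-∀

-- Only the products need ℤ.pos-* below: + a + + b reduces to + (a + b) by computation.
lower-bound : ∀ {n k d m P} → PeripheralCounts n k d m P →
  (+ d) * (+ ⌈ k /2⌉) - ((+ d) - + 3) * ((+ (n C 2)) - (+ (k C 2))) - (+ m) ≤ℤ + P
lower-bound {n} {k} {d} {m} {P} counts = ≤ℤ-fromℕ (lower-cleared counts)
  (trans (cong₂ _-_ (cong₂ (λ x y → + P + + m + x + y) (ℤ.pos-* 3 c) (ℤ.pos-* d N))
                    (cong₂ _+_ (cong₂ _+_ (ℤ.pos-* d h) (ℤ.pos-* d c)) (ℤ.pos-* 3 N)))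
         (lower-identity (+ d) (+ h) (+ c) (+ N) (+ m) (+ P)))
  where
  h = ⌈ k /2⌉
  c = k C 2
  N = n C 2

upper-bound : ∀ {n k d m P} → PeripheralCounts n k d m P →
  + P ≤ℤ ((+ d) - + 1) * (+ (n C 2)) + ((+ d) + + 1) * (+ (k C 2)) - ((+ d) - + 2) * (+ m) - ((+ d) - + 1) * (+ ⌈ k /2⌉)
upper-bound {n} {k} {d} {m} {P} counts = ≤ℤ-fromℕ (upper-cleared counts)
  (trans (cong₂ _-_ (cong₂ (λ x y → x + + c + y + + h)
                            (cong₂ _+_ (ℤ.pos-* d N) (ℤ.pos-* d c)) (ℤ.pos-* 2 m))
                    (cong₂ (λ x y → + P + x + y + + N) (ℤ.pos-* d m) (ℤ.pos-* d h)))
         (upper-identity (+ d) (+ h) (+ c) (+ N) (+ m) (+ P)))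
  where
  h = ⌈ k /2⌉
  c = k C 2
  N = n C 2

mainTheorem6 : ∀ (n : ℕ) → 2 ≤ n → (G : Graph n) → Connected G →
    let m = size G
        d = diam G
        k = length (peri G)
    in ((+ d) * (+ ⌈ k /2⌉) - ((+ d) - + 3) * ((+ (n C 2)) - (+ (k C 2))) - (+ m) ≤ℤ + PW G)
       × (+ PW G ≤ℤ ((+ d) - + 1) * (+ (n C 2)) + ((+ d) + + 1) * (+ (k C 2)) - ((+ d) - + 2) * (+ m) - ((+ d) - + 1) * (+ ⌈ k /2⌉))
mainTheorem6 n 2≤n G _ = lower-bound counts , upper-bound counts
  where counts = peripheral-counts G 2≤n
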